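{- Let $a,b\in\mathbb{Q}$ be such that $f(x)=x^4+ax^2+b$ is irreducible over $\mathbb{Q}$, and let $\theta$ be a root of $f$. Fix a complex square root $\sqrt b$ of $b$. Then for every $r\in\mathbb{Q}\setminus\mathbb{Q}^2$, we have $r\in\mathbb{Q}(\theta)^2$ if and only if at least one of the numbers $r(a^2-4b)$, $r(-a+2\sqrt b)$, $r(-a-2\sqrt b)$ belongs to $\mathbb{Q}^2$.
   Context: $K^2$ denotes the set of squares of elements of a field $K$; "$z\in\mathbb{Q}^2$" for a complex number $z$ means $z$ is the square of a rational number. -}

module Defs where

open import Data.Nat using (ℕ; zero; suc; _≤_)
open import Data.Integer using (+_)
open import Data.Rational using (ℚ; 0ℚ; 1ℚ; _+_; _*_; -_; _-_; _/_)
open import Data.List using (List; []; _∷_; map)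
open import Data.Product using (Σ; ∃; _×_)
open import Data.Sum using (_⊎_)
open import Relation.Binary.PropositionalEquality using (_≡_)
open import Relation.Nullary using (¬_)

-- Polynomials over ℚ as coefficient lists, lowest degree first
-- (trailing zeros allowed; equality is coefficientwise).
Poly : Set
Poly = List ℚ

coeff : Poly → ℕ → ℚ
coeff []       _       = 0ℚ
coeff (c ∷ cs) zero    = c
coeff (c ∷ cs) (suc i) = coeff cs i

infixl 6 _+ₚ_
infixl 7 _*ₚ_
infix 4 _≈ₚ_

_+ₚ_ : Poly → Poly → Poly
[]       +ₚ q        = q
(p ∷ ps) +ₚ []       = p ∷ ps
(p ∷ ps) +ₚ (q ∷ qs) = (p + q) ∷ (ps +ₚ qs)

_*ₚ_ : Poly → Poly → Poly
[]       *ₚ q = []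
(p ∷ ps) *ₚ q = map (p *_) q +ₚ (0ℚ ∷ (ps *ₚ q))

_≈ₚ_ : Poly → Poly → Set
p ≈ₚ q = ∀ i → coeff p i ≡ coeff q i

IsConstant : Poly → Set
IsConstant p = ∀ i → 1 ≤ i → coeff p i ≡ 0ℚ

-- Irreducible over ℚ: nonconstant, and in every factorization one factor
-- is constant (a unit, since the product is nonzero).
Irreducible : Poly → Set
Irreducible f = ¬ IsConstant f × (∀ g h → g *ₚ h ≈ₚ f → IsConstant g ⊎ IsConstant h)

quartic : ℚ → ℚ → Poly
quartic a b = b ∷ 0ℚ ∷ a ∷ 0ℚ ∷ 1ℚ ∷ []

IsSqℚ : ℚ → Set
IsSqℚ x = ∃ λ q → q * q ≡ x

-- r is a square in ℚ(θ) ≅ ℚ[x]/(f), θ ↦ x mod f: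
-- there are polynomials g, h with g² = r + f·h.
IsSqInExt : Poly → ℚ → Set
IsSqInExt f r = Σ Poly λ g → Σ Poly λ h → g *ₚ g ≈ₚ (r ∷ []) +ₚ f *ₚ h

two four : ℚ
two = + 2 / 1
four = + 4 / 1

{-# OPTIONS --safe #-}
module Submission where

-- Let φ = θ², a root of X² + aX + b, so that ℚ(θ) = K ⊕ Kθ with K = ℚ(φ) = ℚ(√Δ), Δ = a² − 4b.
-- Irreducibility of f forces Δ ∉ ℚ² (otherwise f splits into two quadratics in X²), so K is a field.
-- If (u + vθ)² = r ∈ ℚ then 2uv = 0, hence v = 0 or u = 0. If v = 0 then r = u² with u ∈ K, which
-- for r ∉ ℚ² forces u ∈ ℚ√Δ, i.e. rΔ ∈ ℚ². If u = 0 then r = φv², and comparing coordinates shows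
-- b = c² for some c ∈ ℚ with r(2c − a) ∈ ℚ². Conversely each condition gives an explicit square
-- root of r in K ⊕ Kθ, and dividing its square by f gives the required identity in ℚ[X].

open import Defs
open import Data.Rational using (ℚ; _*_; _+_; _-_; -_)
open import Data.Product using (Σ; ∃; _×_)
open import Data.Sum using (_⊎_)
open import Function.Bundles using (_⇔_)
open import Relation.Binary.PropositionalEquality using (_≡_)
open import Relation.Nullary using (¬_)

open import Data.Rational using (0ℚ; 1ℚ; 1/_; ≢-nonZero)
open import Data.Rational.Properties
  using (_≟_; +-*-commutativeRing; +-identityˡ; +-identityʳ;
         *-identityˡ; *-identityʳ; *-assoc; *-zeroʳ; *-inverseˡ; *-inverseʳ)
open import Data.List using ([]; _∷_; map)
open import Data.List.Relation.Binary.Pointwise as Pointwise using (Pointwise-≡⇒≡)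
open import Data.Nat using (zero; suc; s≤s; z≤n)
open import Data.Product using (_,_)
open import Data.Sum using (inj₁; inj₂; [_,_]′; reduce)
open import Data.Sum.Function.Propositional using (_⊎-⇔_)
open import Function.Bundles using (mk⇔)
open import Function.Construct.Composition using (_⇔-∘_)
open import Function.Properties.Equivalence using (⇔-setoid)
import Relation.Binary.Reasoning.Setoid as SetoidReasoning
open import Level using (0ℓ)
open import Function.Base using (_∘_)
open import Relation.Binary.PropositionalEquality
  using (_≢_; refl; sym; trans; cong; cong₂; subst; module ≡-Reasoning)
open import Relation.Nullary using (yes; no; contradiction)
open import Relation.Nullary.Decidable using (dec⇒maybe)
open import Tactic.RingSolver using (solve)
open import Tactic.RingSolver.Core.AlmostCommutativeRing
  using (AlmostCommutativeRing; fromCommutativeRing)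

module ⇔-Reasoning = SetoidReasoning (⇔-setoid 0ℓ)

ring : AlmostCommutativeRing _ _
ring = fromCommutativeRing +-*-commutativeRing (λ x → dec⇒maybe (0ℚ ≟ x))

p*q≡0⇒p≡0∨q≡0 : ∀ p q → p * q ≡ 0ℚ → p ≡ 0ℚ ⊎ q ≡ 0ℚ
p*q≡0⇒p≡0∨q≡0 p q pq≡0 with p ≟ 0ℚ
... | yes p≡0 = inj₁ p≡0
... | no p≢0 = inj₂ (begin
  q                 ≡⟨ sym (*-identityˡ q) ⟩
  1ℚ * q            ≡⟨ cong (_* q) (sym (*-inverseˡ p)) ⟩
  (1/ p * p) * q    ≡⟨ *-assoc (1/ p) p q ⟩
  1/ p * (p * q)    ≡⟨ cong (1/ p *_) pq≡0 ⟩
  1/ p * 0ℚ         ≡⟨ *-zeroʳ (1/ p) ⟩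
  0ℚ                ∎)
  where open ≡-Reasoning; instance _ = ≢-nonZero p≢0

p*p≡0⇒p≡0 : ∀ p → p * p ≡ 0ℚ → p ≡ 0ℚ
p*p≡0⇒p≡0 p pp≡0 = reduce (p*q≡0⇒p≡0∨q≡0 p p pp≡0)

p≢0∧p*q≡0⇒q≡0 : ∀ {p q} → p ≢ 0ℚ → p * q ≡ 0ℚ → q ≡ 0ℚ
p≢0∧p*q≡0⇒q≡0 {p} {q} p≢0 pq≡0 = [ (λ p≡0 → contradiction p≡0 p≢0) , (λ q≡0 → q≡0) ]′ (p*q≡0⇒p≡0∨q≡0 p q pq≡0)

half : ℚ
half = 1/ two

two≢0 : two ≢ 0ℚ
two≢0 ()

[p/q]²≡d : ∀ {p q q⁻¹ d} → q * q⁻¹ ≡ 1ℚ → p * p ≡ d * (q * q) → (p * q⁻¹) * (p * q⁻¹) ≡ d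
[p/q]²≡d {p} {q} {q⁻¹} {d} qq⁻¹≡1 pp≡dqq = begin
  (p * q⁻¹) * (p * q⁻¹)          ≡⟨ solve (p ∷ q⁻¹ ∷ []) ring ⟩
  (p * p) * (q⁻¹ * q⁻¹)          ≡⟨ cong (_* (q⁻¹ * q⁻¹)) pp≡dqq ⟩
  d * (q * q) * (q⁻¹ * q⁻¹)      ≡⟨ solve (d ∷ q ∷ q⁻¹ ∷ []) ring ⟩
  d * ((q * q⁻¹) * (q * q⁻¹))    ≡⟨ cong (λ x → d * (x * x)) qq⁻¹≡1 ⟩
  d * (1ℚ * 1ℚ)                  ≡⟨ solve (d ∷ []) ring ⟩
  d                              ∎
  where open ≡-Reasoning

inverse : ∀ p → p ≢ 0ℚ → ∃ λ p⁻¹ → p * p⁻¹ ≡ 1ℚ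
inverse p p≢0 = 1/ p , *-inverseʳ p
  where instance _ = ≢-nonZero p≢0

IsSqℚ-cancel : ∀ {d q} → q ≢ 0ℚ → IsSqℚ (d * (q * q)) → IsSqℚ d
IsSqℚ-cancel {q = q} q≢0 (p , pp≡dqq) with inverse q q≢0
... | q⁻¹ , qq⁻¹≡1 = p * q⁻¹ , [p/q]²≡d {p} {q} qq⁻¹≡1 pp≡dqq

coeff-+ₚ : ∀ p q i → coeff (p +ₚ q) i ≡ coeff p i + coeff q i
coeff-+ₚ []       q        i       = sym (+-identityˡ (coeff q i))
coeff-+ₚ (c ∷ p)  []       i       = sym (+-identityʳ (coeff (c ∷ p) i))
coeff-+ₚ (c ∷ p)  (d ∷ q)  zero    = refl
coeff-+ₚ (c ∷ p)  (d ∷ q)  (suc i) = coeff-+ₚ p q i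

module Quartic (a b : ℚ) where

  open ≡-Reasoning

  Δ : ℚ
  Δ = a * a - four * b

  X²+ : ℚ → Poly
  X²+ c = c ∷ 0ℚ ∷ 1ℚ ∷ []

  quartic-factorisation : ∀ d → d * d ≡ Δ → X²+ ((a - d) * half) *ₚ X²+ ((a + d) * half) ≡ quartic a b
  quartic-factorisation d d²≡Δ = Pointwise-≡⇒≡ (constant-term Pointwise.∷
    solve (a ∷ d ∷ []) ring Pointwise.∷ solve (a ∷ d ∷ []) ring Pointwise.∷
    solve (a ∷ d ∷ []) ring Pointwise.∷ solve (a ∷ d ∷ []) ring Pointwise.∷ Pointwise.[])
    where
    constant-term : (a - d) * half * ((a + d) * half) + 0ℚ ≡ b
    constant-term = begin
      (a - d) * half * ((a + d) * half) + 0ℚ      ≡⟨ solve (a ∷ d ∷ []) ring ⟩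
      (a * a - d * d) * half * half               ≡⟨ cong (λ s → (a * a - s) * half * half) d²≡Δ ⟩
      (a * a - (a * a - four * b)) * half * half  ≡⟨ solve (a ∷ b ∷ []) ring ⟩
      b                                           ∎

  irreducible⇒Δ∉ℚ² : Irreducible (quartic a b) → ¬ IsSqℚ Δ
  irreducible⇒Δ∉ℚ² (_ , irreducible) (d , d²≡Δ) =
    [ X²+-nonconstant ((a - d) * half) , X²+-nonconstant ((a + d) * half) ]′
      (irreducible (X²+ ((a - d) * half)) (X²+ ((a + d) * half))
        (λ i → cong (λ p → coeff p i) (quartic-factorisation d d²≡Δ)))
    where
    X²+-nonconstant : ∀ c → ¬ IsConstant (X²+ c)
    X²+-nonconstant c constant with constant 2 (s≤s z≤n)
    ... | ()

  -- φ⟨ x , y ⟩ is x + yφ, where φ² + aφ + b = 0 (φ will be θ²). This type and ℚ[θ] are data types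
  -- rather than records so that their component equations reach the ring solver unfolded.
  data ℚ[φ] : Set where
    φ⟨_,_⟩ : ℚ → ℚ → ℚ[φ]

  re im : ℚ[φ] → ℚ
  re φ⟨ x , _ ⟩ = x
  im φ⟨ _ , y ⟩ = y

  infixl 6 _+φ_
  infixl 7 _*φ_ _*ₗ_
  infixr 8 φ·_

  _+φ_ : ℚ[φ] → ℚ[φ] → ℚ[φ]
  φ⟨ x , y ⟩ +φ φ⟨ x′ , y′ ⟩ = φ⟨ x + x′ , y + y′ ⟩

  _*φ_ : ℚ[φ] → ℚ[φ] → ℚ[φ]
  φ⟨ x , y ⟩ *φ φ⟨ x′ , y′ ⟩ = φ⟨ x * x′ - b * (y * y′) , x * y′ + y * x′ - a * (y * y′) ⟩

  _*ₗ_ : ℚ → ℚ[φ] → ℚ[φ]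
  c *ₗ φ⟨ x , y ⟩ = φ⟨ c * x , c * y ⟩

  ιφ : ℚ → ℚ[φ]
  ιφ x = φ⟨ x , 0ℚ ⟩

  0φ : ℚ[φ]
  0φ = ιφ 0ℚ

  φ·_ : ℚ[φ] → ℚ[φ]
  φ· φ⟨ x , y ⟩ = φ⟨ - (b * y) , x - a * y ⟩

  conj : ℚ[φ] → ℚ[φ]
  conj φ⟨ x , y ⟩ = φ⟨ x - a * y , - y ⟩

  norm : ℚ[φ] → ℚ
  norm φ⟨ x , y ⟩ = x * x - a * (x * y) + b * (y * y)

  φ-ext : ∀ {x y x′ y′} → x ≡ x′ → y ≡ y′ → φ⟨ x , y ⟩ ≡ φ⟨ x′ , y′ ⟩
  φ-ext = cong₂ φ⟨_,_⟩

  *ₗ-cancel : ∀ {c w} → c ≢ 0ℚ → c *ₗ w ≡ 0φ → w ≡ 0φ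
  *ₗ-cancel {w = φ⟨ x , y ⟩} c≢0 cw≡0 =
    φ-ext (p≢0∧p*q≡0⇒q≡0 c≢0 (cong re cw≡0)) (p≢0∧p*q≡0⇒q≡0 c≢0 (cong im cw≡0))

  *φ-zeroˡ : ∀ w → 0φ *φ w ≡ 0φ
  *φ-zeroˡ φ⟨ x , y ⟩ = φ-ext (solve (a ∷ b ∷ x ∷ y ∷ []) ring) (solve (a ∷ b ∷ x ∷ y ∷ []) ring)

  *φ-conj : ∀ u v → (u *φ v) *φ conj v ≡ norm v *ₗ u
  *φ-conj φ⟨ x , y ⟩ φ⟨ x′ , y′ ⟩ = begin
    (φ⟨ x , y ⟩ *φ φ⟨ x′ , y′ ⟩) *φ conj φ⟨ x′ , y′ ⟩
      ≡⟨ φ-ext (solve (a ∷ b ∷ x ∷ y ∷ x′ ∷ y′ ∷ []) ring) (solve (a ∷ b ∷ x ∷ y ∷ x′ ∷ y′ ∷ []) ring) ⟩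
    φ⟨ (x′ * x′ - a * (x′ * y′) + b * (y′ * y′)) * x , (x′ * x′ - a * (x′ * y′) + b * (y′ * y′)) * y ⟩
      ∎

  norm≡0⇒≡0 : ¬ IsSqℚ Δ → ∀ v → norm v ≡ 0ℚ → v ≡ 0φ
  norm≡0⇒≡0 Δ∉ℚ² φ⟨ x , y ⟩ N≡0 with y ≟ 0ℚ
  ... | yes refl = φ-ext (p*p≡0⇒p≡0 x (begin
    x * x                                 ≡⟨ solve (a ∷ b ∷ x ∷ []) ring ⟩
    x * x - a * (x * 0ℚ) + b * (0ℚ * 0ℚ)  ≡⟨ N≡0 ⟩
    0ℚ                                    ∎)) refl
  ... | no y≢0 = contradiction (IsSqℚ-cancel y≢0 (two * x - a * y , (begin
    (two * x - a * y) * (two * x - a * y)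
      ≡⟨ solve (a ∷ b ∷ x ∷ y ∷ []) ring ⟩
    four * (x * x - a * (x * y) + b * (y * y)) + (a * a - four * b) * (y * y)
      ≡⟨ cong (λ n → four * n + (a * a - four * b) * (y * y)) N≡0 ⟩
    four * 0ℚ + (a * a - four * b) * (y * y)
      ≡⟨ solve (a ∷ b ∷ y ∷ []) ring ⟩
    (a * a - four * b) * (y * y)
      ∎))) Δ∉ℚ²

  u*v≡0⇒u≡0∨v≡0 : ¬ IsSqℚ Δ → ∀ u v → u *φ v ≡ 0φ → u ≡ 0φ ⊎ v ≡ 0φ
  u*v≡0⇒u≡0∨v≡0 Δ∉ℚ² u v uv≡0 with norm v ≟ 0ℚ
  ... | yes N≡0 = inj₂ (norm≡0⇒≡0 Δ∉ℚ² v N≡0)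
  ... | no  N≢0 = inj₁ (*ₗ-cancel N≢0 (begin
    norm v *ₗ u         ≡⟨ *φ-conj u v ⟨
    (u *φ v) *φ conj v  ≡⟨ cong (_*φ conj v) uv≡0 ⟩
    0φ *φ conj v        ≡⟨ *φ-zeroˡ (conj v) ⟩
    0φ                  ∎))

  *φ-square : ∀ x y → φ⟨ x , y ⟩ *φ φ⟨ x , y ⟩ ≡ φ⟨ x * x - b * (y * y) , y * (two * x - a * y) ⟩
  *φ-square x y = φ-ext (solve (a ∷ b ∷ x ∷ y ∷ []) ring) (solve (a ∷ b ∷ x ∷ y ∷ []) ring)

  φ·*φ-square : ∀ x y →
    φ· (φ⟨ x , y ⟩ *φ φ⟨ x , y ⟩) ≡ φ⟨ - (b * (y * (two * x - a * y))) , (x - a * y) * (x - a * y) - b * (y * y) ⟩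
  φ·*φ-square x y = φ-ext (solve (a ∷ b ∷ x ∷ y ∷ []) ring) (solve (a ∷ b ∷ x ∷ y ∷ []) ring)

  -- θ⟨ u , v ⟩ is u + vθ with θ² = φ, so θ⟨ φ⟨ p₀ , p₂ ⟩ , φ⟨ p₁ , p₃ ⟩ ⟩ = p₀ + p₁θ + p₂θ² + p₃θ³
  -- and ℚ[θ] is ℚ[X]/(X⁴ + aX² + b).
  data ℚ[θ] : Set where
    θ⟨_,_⟩ : ℚ[φ] → ℚ[φ] → ℚ[θ]

  even odd : ℚ[θ] → ℚ[φ]
  even θ⟨ u , _ ⟩ = u
  odd  θ⟨ _ , v ⟩ = v

  infixl 6 _+θ_
  infixl 7 _*θ_
  infixr 8 θ·_

  _+θ_ : ℚ[θ] → ℚ[θ] → ℚ[θ]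
  θ⟨ u , v ⟩ +θ θ⟨ u′ , v′ ⟩ = θ⟨ u +φ u′ , v +φ v′ ⟩

  _*θ_ : ℚ[θ] → ℚ[θ] → ℚ[θ]
  θ⟨ u , v ⟩ *θ θ⟨ u′ , v′ ⟩ = θ⟨ u *φ u′ +φ φ· (v *φ v′) , u *φ v′ +φ v *φ u′ ⟩

  ιθ : ℚ → ℚ[θ]
  ιθ x = θ⟨ ιφ x , 0φ ⟩

  0θ : ℚ[θ]
  0θ = ιθ 0ℚ

  θ·_ : ℚ[θ] → ℚ[θ]
  θ· θ⟨ u , v ⟩ = θ⟨ φ· v , u ⟩

  θ-ext : ∀ {x₀ x₁ x₂ x₃ y₀ y₁ y₂ y₃} → x₀ ≡ y₀ → x₂ ≡ y₂ → x₁ ≡ y₁ → x₃ ≡ y₃ →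
          θ⟨ φ⟨ x₀ , x₂ ⟩ , φ⟨ x₁ , x₃ ⟩ ⟩ ≡ θ⟨ φ⟨ y₀ , y₂ ⟩ , φ⟨ y₁ , y₃ ⟩ ⟩
  θ-ext e₀ e₂ e₁ e₃ = cong₂ θ⟨_,_⟩ (φ-ext e₀ e₂) (φ-ext e₁ e₃)

  eval : Poly → ℚ[θ]
  eval []       = 0θ
  eval (c ∷ cs) = ιθ c +θ θ· eval cs

  eval-+ₚ : ∀ p q → eval (p +ₚ q) ≡ eval p +θ eval q
  eval-+ₚ []      q       = sym (+θ-identityˡ (eval q))
    where
    +θ-identityˡ : ∀ X → 0θ +θ X ≡ X
    +θ-identityˡ θ⟨ φ⟨ x₀ , x₂ ⟩ , φ⟨ x₁ , x₃ ⟩ ⟩ =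
      θ-ext (+-identityˡ x₀) (+-identityˡ x₂) (+-identityˡ x₁) (+-identityˡ x₃)
  eval-+ₚ (c ∷ p) []      = sym (+θ-identityʳ (eval (c ∷ p)))
    where
    +θ-identityʳ : ∀ X → X +θ 0θ ≡ X
    +θ-identityʳ θ⟨ φ⟨ x₀ , x₂ ⟩ , φ⟨ x₁ , x₃ ⟩ ⟩ =
      θ-ext (+-identityʳ x₀) (+-identityʳ x₂) (+-identityʳ x₁) (+-identityʳ x₃)
  eval-+ₚ (c ∷ p) (d ∷ q) = begin
    ιθ (c + d) +θ θ· eval (p +ₚ q)              ≡⟨ cong (λ X → ιθ (c + d) +θ θ· X) (eval-+ₚ p q) ⟩
    ιθ (c + d) +θ θ· (eval p +θ eval q)         ≡⟨ horner-+ (eval p) (eval q) ⟩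
    (ιθ c +θ θ· eval p) +θ (ιθ d +θ θ· eval q)  ∎
    where
    horner-+ : ∀ X Y → ιθ (c + d) +θ θ· (X +θ Y) ≡ (ιθ c +θ θ· X) +θ (ιθ d +θ θ· Y)
    horner-+ θ⟨ φ⟨ x₀ , x₂ ⟩ , φ⟨ x₁ , x₃ ⟩ ⟩ θ⟨ φ⟨ y₀ , y₂ ⟩ , φ⟨ y₁ , y₃ ⟩ ⟩ =
      θ-ext (solve (a ∷ b ∷ c ∷ d ∷ x₀ ∷ x₁ ∷ x₂ ∷ x₃ ∷ y₀ ∷ y₁ ∷ y₂ ∷ y₃ ∷ []) ring)
            (solve (a ∷ b ∷ c ∷ d ∷ x₀ ∷ x₁ ∷ x₂ ∷ x₃ ∷ y₀ ∷ y₁ ∷ y₂ ∷ y₃ ∷ []) ring)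
            (solve (a ∷ b ∷ c ∷ d ∷ x₀ ∷ x₁ ∷ x₂ ∷ x₃ ∷ y₀ ∷ y₁ ∷ y₂ ∷ y₃ ∷ []) ring)
            (solve (a ∷ b ∷ c ∷ d ∷ x₀ ∷ x₁ ∷ x₂ ∷ x₃ ∷ y₀ ∷ y₁ ∷ y₂ ∷ y₃ ∷ []) ring)

  eval-map-* : ∀ c q → eval (map (c *_) q) ≡ ιθ c *θ eval q
  eval-map-* c []      = θ-ext (solve (a ∷ b ∷ c ∷ []) ring) (solve (a ∷ b ∷ c ∷ []) ring)
                               (solve (a ∷ b ∷ c ∷ []) ring) (solve (a ∷ b ∷ c ∷ []) ring)
  eval-map-* c (d ∷ q) = begin
    ιθ (c * d) +θ θ· eval (map (c *_) q)  ≡⟨ cong (λ X → ιθ (c * d) +θ θ· X) (eval-map-* c q) ⟩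
    ιθ (c * d) +θ θ· (ιθ c *θ eval q)     ≡⟨ horner-map-* (eval q) ⟩
    ιθ c *θ (ιθ d +θ θ· eval q)           ∎
    where
    horner-map-* : ∀ X → ιθ (c * d) +θ θ· (ιθ c *θ X) ≡ ιθ c *θ (ιθ d +θ θ· X)
    horner-map-* θ⟨ φ⟨ x₀ , x₂ ⟩ , φ⟨ x₁ , x₃ ⟩ ⟩ =
      θ-ext (solve (a ∷ b ∷ c ∷ d ∷ x₀ ∷ x₁ ∷ x₂ ∷ x₃ ∷ []) ring)
            (solve (a ∷ b ∷ c ∷ d ∷ x₀ ∷ x₁ ∷ x₂ ∷ x₃ ∷ []) ring)
            (solve (a ∷ b ∷ c ∷ d ∷ x₀ ∷ x₁ ∷ x₂ ∷ x₃ ∷ []) ring)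
            (solve (a ∷ b ∷ c ∷ d ∷ x₀ ∷ x₁ ∷ x₂ ∷ x₃ ∷ []) ring)

  eval-*ₚ : ∀ p q → eval (p *ₚ q) ≡ eval p *θ eval q
  eval-*ₚ []      q = sym (*θ-zeroˡ (eval q))
    where
    *θ-zeroˡ : ∀ Y → 0θ *θ Y ≡ 0θ
    *θ-zeroˡ θ⟨ φ⟨ y₀ , y₂ ⟩ , φ⟨ y₁ , y₃ ⟩ ⟩ =
      θ-ext (solve (a ∷ b ∷ y₀ ∷ y₁ ∷ y₂ ∷ y₃ ∷ []) ring) (solve (a ∷ b ∷ y₀ ∷ y₁ ∷ y₂ ∷ y₃ ∷ []) ring)
            (solve (a ∷ b ∷ y₀ ∷ y₁ ∷ y₂ ∷ y₃ ∷ []) ring) (solve (a ∷ b ∷ y₀ ∷ y₁ ∷ y₂ ∷ y₃ ∷ []) ring)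
  eval-*ₚ (c ∷ p) q = begin
    eval (map (c *_) q +ₚ (0ℚ ∷ p *ₚ q))
      ≡⟨ eval-+ₚ (map (c *_) q) (0ℚ ∷ p *ₚ q) ⟩
    eval (map (c *_) q) +θ (ιθ 0ℚ +θ θ· eval (p *ₚ q))
      ≡⟨ cong₂ (λ X Y → X +θ (ιθ 0ℚ +θ θ· Y)) (eval-map-* c q) (eval-*ₚ p q) ⟩
    ιθ c *θ eval q +θ (ιθ 0ℚ +θ θ· (eval p *θ eval q))
      ≡⟨ horner-* (eval p) (eval q) ⟩
    (ιθ c +θ θ· eval p) *θ eval q
      ∎
    where
    horner-* : ∀ X Y → ιθ c *θ Y +θ (ιθ 0ℚ +θ θ· (X *θ Y)) ≡ (ιθ c +θ θ· X) *θ Y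
    horner-* θ⟨ φ⟨ x₀ , x₂ ⟩ , φ⟨ x₁ , x₃ ⟩ ⟩ θ⟨ φ⟨ y₀ , y₂ ⟩ , φ⟨ y₁ , y₃ ⟩ ⟩ =
      θ-ext (solve (a ∷ b ∷ c ∷ x₀ ∷ x₁ ∷ x₂ ∷ x₃ ∷ y₀ ∷ y₁ ∷ y₂ ∷ y₃ ∷ []) ring)
            (solve (a ∷ b ∷ c ∷ x₀ ∷ x₁ ∷ x₂ ∷ x₃ ∷ y₀ ∷ y₁ ∷ y₂ ∷ y₃ ∷ []) ring)
            (solve (a ∷ b ∷ c ∷ x₀ ∷ x₁ ∷ x₂ ∷ x₃ ∷ y₀ ∷ y₁ ∷ y₂ ∷ y₃ ∷ []) ring)
            (solve (a ∷ b ∷ c ∷ x₀ ∷ x₁ ∷ x₂ ∷ x₃ ∷ y₀ ∷ y₁ ∷ y₂ ∷ y₃ ∷ []) ring)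

  eval-zero : ∀ p → (∀ i → coeff p i ≡ 0ℚ) → eval p ≡ 0θ
  eval-zero []       _    = refl
  eval-zero (c ∷ cs) p≡0 = begin
    ιθ c +θ θ· eval cs   ≡⟨ cong₂ (λ x X → ιθ x +θ θ· X) (p≡0 0) (eval-zero cs (p≡0 ∘ suc)) ⟩
    ιθ 0ℚ +θ θ· 0θ       ≡⟨ horner-zero ⟩
    0θ                   ∎
    where
    horner-zero : ιθ 0ℚ +θ θ· 0θ ≡ 0θ
    horner-zero = θ-ext (solve (a ∷ b ∷ []) ring) (solve (a ∷ b ∷ []) ring)
                        (solve (a ∷ b ∷ []) ring) (solve (a ∷ b ∷ []) ring)

  eval-≈ₚ : ∀ p q → p ≈ₚ q → eval p ≡ eval q
  eval-≈ₚ []       q        p≈q = sym (eval-zero q (sym ∘ p≈q))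
  eval-≈ₚ (c ∷ cs) []       p≈q = eval-zero (c ∷ cs) p≈q
  eval-≈ₚ (c ∷ cs) (d ∷ ds) p≈q = cong₂ (λ x X → ιθ x +θ θ· X) (p≈q 0) (eval-≈ₚ cs ds (p≈q ∘ suc))

  eval-quartic : eval (quartic a b) ≡ 0θ
  eval-quartic = θ-ext (solve (a ∷ b ∷ []) ring) (solve (a ∷ b ∷ []) ring)
                       (solve (a ∷ b ∷ []) ring) (solve (a ∷ b ∷ []) ring)

  IsSqℚ[θ] : ℚ → Set
  IsSqℚ[θ] r = ∃ λ G → G *θ G ≡ ιθ r

  IsSqInExt⇒IsSqℚ[θ] : ∀ {r} → IsSqInExt (quartic a b) r → IsSqℚ[θ] r
  IsSqInExt⇒IsSqℚ[θ] {r} (g , h , g²≈r+fh) = eval g , (begin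
    eval g *θ eval g                               ≡⟨ eval-*ₚ g g ⟨
    eval (g *ₚ g)                                  ≡⟨ eval-≈ₚ (g *ₚ g) ((r ∷ []) +ₚ quartic a b *ₚ h) g²≈r+fh ⟩
    eval ((r ∷ []) +ₚ quartic a b *ₚ h)            ≡⟨ eval-+ₚ (r ∷ []) (quartic a b *ₚ h) ⟩
    eval (r ∷ []) +θ eval (quartic a b *ₚ h)       ≡⟨ cong (eval (r ∷ []) +θ_) (eval-*ₚ (quartic a b) h) ⟩
    eval (r ∷ []) +θ eval (quartic a b) *θ eval h  ≡⟨ cong (λ F → eval (r ∷ []) +θ F *θ eval h) eval-quartic ⟩
    eval (r ∷ []) +θ 0θ *θ eval h                  ≡⟨ ιr+0*H≡ιr (eval h) ⟩
    ιθ r                                           ∎)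
    where
    ιr+0*H≡ιr : ∀ H → eval (r ∷ []) +θ 0θ *θ H ≡ ιθ r
    ιr+0*H≡ιr θ⟨ φ⟨ h₀ , h₂ ⟩ , φ⟨ h₁ , h₃ ⟩ ⟩ =
      θ-ext (solve (a ∷ b ∷ r ∷ h₀ ∷ h₁ ∷ h₂ ∷ h₃ ∷ []) ring) (solve (a ∷ b ∷ r ∷ h₀ ∷ h₁ ∷ h₂ ∷ h₃ ∷ []) ring)
            (solve (a ∷ b ∷ r ∷ h₀ ∷ h₁ ∷ h₂ ∷ h₃ ∷ []) ring) (solve (a ∷ b ∷ r ∷ h₀ ∷ h₁ ∷ h₂ ∷ h₃ ∷ []) ring)

  coefficients : ℚ[θ] → Poly
  coefficients θ⟨ φ⟨ p₀ , p₂ ⟩ , φ⟨ p₁ , p₃ ⟩ ⟩ = p₀ ∷ p₁ ∷ p₂ ∷ p₃ ∷ []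

  coefficients-ιθ : ∀ r → coefficients (ιθ r) ≈ₚ r ∷ []
  coefficients-ιθ r zero                      = refl
  coefficients-ιθ r (suc zero)                = refl
  coefficients-ιθ r (suc (suc zero))          = refl
  coefficients-ιθ r (suc (suc (suc zero)))    = refl
  coefficients-ιθ r (suc (suc (suc (suc _)))) = refl

  square-quotient : ℚ[θ] → Poly
  square-quotient θ⟨ φ⟨ p₀ , p₂ ⟩ , φ⟨ p₁ , p₃ ⟩ ⟩ =
    p₂ * p₂ + two * (p₁ * p₃) - a * (p₃ * p₃) ∷ two * (p₂ * p₃) ∷ p₃ * p₃ ∷ []

  square-division : ∀ G →
    coefficients G *ₚ coefficients G ≡ coefficients (G *θ G) +ₚ quartic a b *ₚ square-quotient G
  square-division θ⟨ φ⟨ p₀ , p₂ ⟩ , φ⟨ p₁ , p₃ ⟩ ⟩ = Pointwise-≡⇒≡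
    ( solve (a ∷ b ∷ p₀ ∷ p₁ ∷ p₂ ∷ p₃ ∷ []) ring Pointwise.∷ solve (a ∷ b ∷ p₀ ∷ p₁ ∷ p₂ ∷ p₃ ∷ []) ring
    Pointwise.∷ solve (a ∷ b ∷ p₀ ∷ p₁ ∷ p₂ ∷ p₃ ∷ []) ring Pointwise.∷ solve (a ∷ b ∷ p₀ ∷ p₁ ∷ p₂ ∷ p₃ ∷ []) ring
    Pointwise.∷ solve (a ∷ b ∷ p₀ ∷ p₁ ∷ p₂ ∷ p₃ ∷ []) ring Pointwise.∷ solve (a ∷ b ∷ p₀ ∷ p₁ ∷ p₂ ∷ p₃ ∷ []) ring
    Pointwise.∷ solve (a ∷ b ∷ p₀ ∷ p₁ ∷ p₂ ∷ p₃ ∷ []) ring Pointwise.∷ Pointwise.[])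

  IsSqℚ[θ]⇒IsSqInExt : ∀ {r} → IsSqℚ[θ] r → IsSqInExt (quartic a b) r
  IsSqℚ[θ]⇒IsSqInExt {r} (G , G²≡r) = coefficients G , square-quotient G , λ i → begin
    coeff (g *ₚ g) i                             ≡⟨ cong (λ p → coeff p i) (square-division G) ⟩
    coeff (coefficients (G *θ G) +ₚ fh) i        ≡⟨ coeff-+ₚ (coefficients (G *θ G)) fh i ⟩
    coeff (coefficients (G *θ G)) i + coeff fh i ≡⟨ cong (λ X → coeff (coefficients X) i + coeff fh i) G²≡r ⟩
    coeff (coefficients (ιθ r)) i + coeff fh i   ≡⟨ cong (_+ coeff fh i) (coefficients-ιθ r i) ⟩
    coeff (r ∷ []) i + coeff fh i                ≡⟨ coeff-+ₚ (r ∷ []) fh i ⟨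
    coeff ((r ∷ []) +ₚ fh) i                     ∎
    where
    g fh : Poly
    g  = coefficients G
    fh = quartic a b *ₚ square-quotient G

  IsSqInExt⇔IsSqℚ[θ] : ∀ {r} → IsSqInExt (quartic a b) r ⇔ IsSqℚ[θ] r
  IsSqInExt⇔IsSqℚ[θ] = mk⇔ IsSqInExt⇒IsSqℚ[θ] IsSqℚ[θ]⇒IsSqInExt

  *θ-square : ∀ u v → θ⟨ u , v ⟩ *θ θ⟨ u , v ⟩ ≡ θ⟨ u *φ u +φ φ· (v *φ v) , two *ₗ (u *φ v) ⟩
  *θ-square φ⟨ x₀ , x₂ ⟩ φ⟨ x₁ , x₃ ⟩ =
    θ-ext (solve (a ∷ b ∷ x₀ ∷ x₁ ∷ x₂ ∷ x₃ ∷ []) ring) (solve (a ∷ b ∷ x₀ ∷ x₁ ∷ x₂ ∷ x₃ ∷ []) ring)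
          (solve (a ∷ b ∷ x₀ ∷ x₁ ∷ x₂ ∷ x₃ ∷ []) ring) (solve (a ∷ b ∷ x₀ ∷ x₁ ∷ x₂ ∷ x₃ ∷ []) ring)

  *θ-square-even : ∀ u → θ⟨ u , 0φ ⟩ *θ θ⟨ u , 0φ ⟩ ≡ θ⟨ u *φ u , 0φ ⟩
  *θ-square-even φ⟨ x₀ , x₂ ⟩ =
    θ-ext (solve (a ∷ b ∷ x₀ ∷ x₂ ∷ []) ring) (solve (a ∷ b ∷ x₀ ∷ x₂ ∷ []) ring)
          (solve (a ∷ b ∷ x₀ ∷ x₂ ∷ []) ring) (solve (a ∷ b ∷ x₀ ∷ x₂ ∷ []) ring)

  *θ-square-odd : ∀ v → θ⟨ 0φ , v ⟩ *θ θ⟨ 0φ , v ⟩ ≡ θ⟨ φ· (v *φ v) , 0φ ⟩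
  *θ-square-odd φ⟨ x₁ , x₃ ⟩ =
    θ-ext (solve (a ∷ b ∷ x₁ ∷ x₃ ∷ []) ring) (solve (a ∷ b ∷ x₁ ∷ x₃ ∷ []) ring)
          (solve (a ∷ b ∷ x₁ ∷ x₃ ∷ []) ring) (solve (a ∷ b ∷ x₁ ∷ x₃ ∷ []) ring)

  IsSqℚ[φ] IsφSqℚ[φ] : ℚ → Set
  IsSqℚ[φ]  r = ∃ λ u → u *φ u ≡ ιφ r
  IsφSqℚ[φ] r = ∃ λ v → φ· (v *φ v) ≡ ιφ r

  IsSqℚ[θ]⇔IsSqℚ[φ]⊎IsφSqℚ[φ] : ¬ IsSqℚ Δ → ∀ {r} → IsSqℚ[θ] r ⇔ (IsSqℚ[φ] r ⊎ IsφSqℚ[φ] r)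
  IsSqℚ[θ]⇔IsSqℚ[φ]⊎IsφSqℚ[φ] Δ∉ℚ² {r} = mk⇔ to from
    where
    to : IsSqℚ[θ] r → IsSqℚ[φ] r ⊎ IsφSqℚ[φ] r
    to (θ⟨ u , v ⟩ , G²≡r)
      with u*v≡0⇒u≡0∨v≡0 Δ∉ℚ² u v (*ₗ-cancel two≢0 (cong odd (trans (sym (*θ-square u v)) G²≡r)))
    ... | inj₁ refl = inj₂ (v , cong even (trans (sym (*θ-square-odd v)) G²≡r))
    ... | inj₂ refl = inj₁ (u , cong even (trans (sym (*θ-square-even u)) G²≡r))
    from : IsSqℚ[φ] r ⊎ IsφSqℚ[φ] r → IsSqℚ[θ] r
    from (inj₁ (u , u²≡r))  = θ⟨ u , 0φ ⟩ , trans (*θ-square-even u) (cong θ⟨_, 0φ ⟩ u²≡r)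
    from (inj₂ (v , φv²≡r)) = θ⟨ 0φ , v ⟩ , trans (*θ-square-odd v) (cong θ⟨_, 0φ ⟩ φv²≡r)

  Δ≢0 : ¬ IsSqℚ Δ → Δ ≢ 0ℚ
  Δ≢0 Δ∉ℚ² Δ≡0 = Δ∉ℚ² (0ℚ , sym Δ≡0)

  IsSqℚ[φ]⇔IsSqℚ[r*Δ] : ¬ IsSqℚ Δ → ∀ {r} → ¬ IsSqℚ r → IsSqℚ[φ] r ⇔ IsSqℚ (r * Δ)
  IsSqℚ[φ]⇔IsSqℚ[r*Δ] Δ∉ℚ² {r} r∉ℚ² = mk⇔ to from
    where
    to : IsSqℚ[φ] r → IsSqℚ (r * Δ)
    to (φ⟨ x , y ⟩ , u²≡r) =
      [ (λ y≡0 → contradiction (x , x²≡r y≡0) r∉ℚ²) , rΔ∈ℚ² ]′ (p*q≡0⇒p≡0∨q≡0 y (two * x - a * y) (cong im u²≡r′))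
      where
      u²≡r′ : φ⟨ x * x - b * (y * y) , y * (two * x - a * y) ⟩ ≡ ιφ r
      u²≡r′ = trans (sym (*φ-square x y)) u²≡r
      x²-by²≡r : x * x - b * (y * y) ≡ r
      x²-by²≡r = cong re u²≡r′
      x²≡r : y ≡ 0ℚ → x * x ≡ r
      x²≡r y≡0 = begin
        x * x                    ≡⟨ solve (b ∷ x ∷ []) ring ⟩
        x * x - b * (0ℚ * 0ℚ)    ≡⟨ cong (λ y → x * x - b * (y * y)) y≡0 ⟨
        x * x - b * (y * y)      ≡⟨ x²-by²≡r ⟩
        r                        ∎
      rΔ∈ℚ² : two * x - a * y ≡ 0ℚ → IsSqℚ (r * Δ)
      rΔ∈ℚ² 2x-ay≡0 = IsSqℚ-cancel two≢0 (y * (a * a - four * b) , (begin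
        (y * (a * a - four * b)) * (y * (a * a - four * b))
          ≡⟨ solve (a ∷ b ∷ x ∷ y ∷ []) ring ⟩
        (a * a - four * b) * (four * (x * x - b * (y * y)) - (two * x - a * y) * (two * x + a * y))
          ≡⟨ cong₂ (λ s t → (a * a - four * b) * (four * s - t * (two * x + a * y))) x²-by²≡r 2x-ay≡0 ⟩
        (a * a - four * b) * (four * r - 0ℚ * (two * x + a * y))
          ≡⟨ solve (a ∷ b ∷ r ∷ x ∷ y ∷ []) ring ⟩
        r * (a * a - four * b) * (two * two)
          ∎))
    from : IsSqℚ (r * Δ) → IsSqℚ[φ] r
    from (q , q²≡rΔ) with inverse Δ (Δ≢0 Δ∉ℚ²)
    ... | Δ⁻¹ , ΔΔ⁻¹≡1 =
      φ⟨ q * Δ⁻¹ * a , two * (q * Δ⁻¹) ⟩ ,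
      trans (*φ-square (q * Δ⁻¹ * a) (two * (q * Δ⁻¹))) (φ-ext (begin
        q * Δ⁻¹ * a * (q * Δ⁻¹ * a) - b * (two * (q * Δ⁻¹) * (two * (q * Δ⁻¹)))
          ≡⟨ solve (a ∷ b ∷ q ∷ Δ⁻¹ ∷ []) ring ⟩
        q * q * (Δ⁻¹ * Δ⁻¹) * (a * a - four * b)
          ≡⟨ cong (λ s → s * (Δ⁻¹ * Δ⁻¹) * (a * a - four * b)) q²≡rΔ ⟩
        r * (a * a - four * b) * (Δ⁻¹ * Δ⁻¹) * (a * a - four * b)
          ≡⟨ solve (a ∷ b ∷ r ∷ Δ⁻¹ ∷ []) ring ⟩
        r * ((a * a - four * b) * Δ⁻¹ * ((a * a - four * b) * Δ⁻¹))
          ≡⟨ cong (λ s → r * (s * s)) ΔΔ⁻¹≡1 ⟩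
        r * (1ℚ * 1ℚ)
          ≡⟨ solve (r ∷ []) ring ⟩
        r ∎)
        (solve (a ∷ q ∷ Δ⁻¹ ∷ []) ring))

  [2c-a]*c≢0 : ¬ IsSqℚ Δ → ∀ {c} → c * c ≡ b → (- a + two * c) * c ≢ 0ℚ
  [2c-a]*c≢0 Δ∉ℚ² {c} c²≡b ec≡0 = [ e≢0 , c≢0 ]′ (p*q≡0⇒p≡0∨q≡0 (- a + two * c) c ec≡0)
    where
    Δ≡a²-4c² : a * a - four * b ≡ a * a - four * (c * c)
    Δ≡a²-4c² = cong (λ s → a * a - four * s) (sym c²≡b)
    e≢0 : - a + two * c ≢ 0ℚ
    e≢0 e≡0 = Δ∉ℚ² (0ℚ , sym (begin
      a * a - four * b                     ≡⟨ Δ≡a²-4c² ⟩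
      a * a - four * (c * c)               ≡⟨ solve (a ∷ c ∷ []) ring ⟩
      - ((- a + two * c) * (a + two * c))  ≡⟨ cong (λ e → - (e * (a + two * c))) e≡0 ⟩
      - (0ℚ * (a + two * c))               ≡⟨ solve (a ∷ c ∷ []) ring ⟩
      0ℚ * 0ℚ                              ∎))
    c≢0 : c ≢ 0ℚ
    c≢0 c≡0 = Δ∉ℚ² (a , sym (begin
      a * a - four * b                     ≡⟨ Δ≡a²-4c² ⟩
      a * a - four * (c * c)               ≡⟨ cong (λ c → a * a - four * (c * c)) c≡0 ⟩
      a * a - four * (0ℚ * 0ℚ)             ≡⟨ solve (a ∷ []) ring ⟩
      a * a                                ∎))

  φv²≡r⇒IsSqℚ : ∀ r x y c → - (b * (y * (two * x - a * y))) ≡ r → c * y ≡ a * y - x → c * c ≡ b →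
                IsSqℚ (r * (- a + two * c))
  φv²≡r⇒IsSqℚ r x y c r≡ cy≡ay-x c²≡b = c * (a * y - two * x) , (begin
    c * (a * y - two * x) * (c * (a * y - two * x))
      ≡⟨ solve (a ∷ c ∷ x ∷ y ∷ []) ring ⟩
    c * c * ((a * y - two * x) * (a * y - two * x))
      ≡⟨ cong (λ s → s * ((a * y - two * x) * (a * y - two * x))) c²≡b ⟩
    b * ((a * y - two * x) * (a * y - two * x))
      ≡⟨ solve (a ∷ b ∷ x ∷ y ∷ []) ring ⟩
    - (b * (two * x - a * y)) * (- (a * y) + two * (a * y - x))
      ≡⟨ cong (λ s → - (b * (two * x - a * y)) * (- (a * y) + two * s)) cy≡ay-x ⟨
    - (b * (two * x - a * y)) * (- (a * y) + two * (c * y))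
      ≡⟨ solve (a ∷ b ∷ c ∷ x ∷ y ∷ []) ring ⟩
    - (b * (y * (two * x - a * y))) * (- a + two * c)
      ≡⟨ cong (_* (- a + two * c)) r≡ ⟩
    r * (- a + two * c)
      ∎)

  φv²≡r⇒√b : ∀ {r} → ¬ IsSqℚ r → ∀ x y →
    - (b * (y * (two * x - a * y))) ≡ r → (x - a * y) * (x - a * y) - b * (y * y) ≡ 0ℚ →
    ∃ λ c → c * c ≡ b × IsSqℚ (r * (- a + two * c))
  φv²≡r⇒√b {r} r∉ℚ² x y r≡ [x-ay]²≡by² with y ≟ 0ℚ
  ... | yes y≡0 = contradiction (0ℚ , (begin
    0ℚ * 0ℚ                            ≡⟨ solve (a ∷ b ∷ x ∷ []) ring ⟩
    - (b * (0ℚ * (two * x - a * 0ℚ)))  ≡⟨ cong (λ y → - (b * (y * (two * x - a * y)))) y≡0 ⟨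
    - (b * (y * (two * x - a * y)))    ≡⟨ r≡ ⟩
    r                                  ∎)) r∉ℚ²
  ... | no y≢0 = root (inverse y y≢0)
    where
    root : (∃ λ y⁻¹ → y * y⁻¹ ≡ 1ℚ) → ∃ λ c → c * c ≡ b × IsSqℚ (r * (- a + two * c))
    root (y⁻¹ , yy⁻¹≡1) = (a * y - x) * y⁻¹ , c²≡b , φv²≡r⇒IsSqℚ r x y ((a * y - x) * y⁻¹) r≡ cy≡ay-x c²≡b
      where
      c²≡b : (a * y - x) * y⁻¹ * ((a * y - x) * y⁻¹) ≡ b
      c²≡b = [p/q]²≡d {a * y - x} {y} yy⁻¹≡1 (begin
        (a * y - x) * (a * y - x)                              ≡⟨ solve (a ∷ b ∷ x ∷ y ∷ []) ring ⟩
        (x - a * y) * (x - a * y) - b * (y * y) + b * (y * y)  ≡⟨ cong (_+ b * (y * y)) [x-ay]²≡by² ⟩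
        0ℚ + b * (y * y)                                       ≡⟨ +-identityˡ (b * (y * y)) ⟩
        b * (y * y)                                            ∎)
      cy≡ay-x : (a * y - x) * y⁻¹ * y ≡ a * y - x
      cy≡ay-x = begin
        (a * y - x) * y⁻¹ * y    ≡⟨ solve (a ∷ x ∷ y ∷ y⁻¹ ∷ []) ring ⟩
        (a * y - x) * (y * y⁻¹)  ≡⟨ cong ((a * y - x) *_) yy⁻¹≡1 ⟩
        (a * y - x) * 1ℚ         ≡⟨ *-identityʳ (a * y - x) ⟩
        a * y - x                ∎

  IsφSqℚ[φ]⇔IsSqℚ[r*[2c-a]] : ¬ IsSqℚ Δ → ∀ {r} → ¬ IsSqℚ r →
    IsφSqℚ[φ] r ⇔ (∃ λ c → c * c ≡ b × IsSqℚ (r * (- a + two * c)))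
  IsφSqℚ[φ]⇔IsSqℚ[r*[2c-a]] Δ∉ℚ² {r} r∉ℚ² = mk⇔ to from
    where
    to : IsφSqℚ[φ] r → ∃ λ c → c * c ≡ b × IsSqℚ (r * (- a + two * c))
    to (φ⟨ x , y ⟩ , φv²≡r) =
      φv²≡r⇒√b r∉ℚ² x y (cong re φv²≡r′) (cong im φv²≡r′)
      where
      φv²≡r′ : φ⟨ - (b * (y * (two * x - a * y))) , (x - a * y) * (x - a * y) - b * (y * y) ⟩ ≡ ιφ r
      φv²≡r′ = trans (sym (φ·*φ-square x y)) φv²≡r
    from : (∃ λ c → c * c ≡ b × IsSqℚ (r * (- a + two * c))) → IsφSqℚ[φ] r
    from (c , c²≡b , q , q²≡re) = square-root (inverse ((- a + two * c) * c) ([2c-a]*c≢0 Δ∉ℚ² c²≡b))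
      where
      square-root : (∃ λ i → (- a + two * c) * c * i ≡ 1ℚ) → IsφSqℚ[φ] r
      square-root (i , eci≡1) =
        φ⟨ q * i * (a - c) , q * i ⟩ ,
        trans (φ·*φ-square (q * i * (a - c)) (q * i)) (φ-ext (begin
          - (b * (q * i * (two * (q * i * (a - c)) - a * (q * i))))
            ≡⟨ solve (a ∷ b ∷ c ∷ q ∷ i ∷ []) ring ⟩
          b * (q * q) * (i * i) * (- a + two * c)
            ≡⟨ cong₂ (λ s t → s * t * (i * i) * (- a + two * c)) (sym c²≡b) q²≡re ⟩
          c * c * (r * (- a + two * c)) * (i * i) * (- a + two * c)
            ≡⟨ solve (a ∷ c ∷ r ∷ i ∷ []) ring ⟩
          r * ((- a + two * c) * c * i * ((- a + two * c) * c * i))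
            ≡⟨ cong (λ s → r * (s * s)) eci≡1 ⟩
          r * (1ℚ * 1ℚ)
            ≡⟨ solve (r ∷ []) ring ⟩
          r ∎) (begin
          (q * i * (a - c) - a * (q * i)) * (q * i * (a - c) - a * (q * i)) - b * (q * i * (q * i))
            ≡⟨ solve (a ∷ b ∷ c ∷ q ∷ i ∷ []) ring ⟩
          (c * c - b) * (q * i * (q * i))
            ≡⟨ cong (λ s → (s - b) * (q * i * (q * i))) c²≡b ⟩
          (b - b) * (q * i * (q * i))
            ≡⟨ solve (b ∷ q ∷ i ∷ []) ring ⟩
          0ℚ ∎))

  ±√b : ∀ {r} →
    (∃ λ c → c * c ≡ b × IsSqℚ (r * (- a + two * c))) ⇔
    (∃ λ c → c * c ≡ b × (IsSqℚ (r * (- a + two * c)) ⊎ IsSqℚ (r * (- a - two * c))))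
  ±√b {r} = mk⇔ (λ (c , c²≡b , sq) → c , c²≡b , inj₁ sq) from
    where
    from : (∃ λ c → c * c ≡ b × (IsSqℚ (r * (- a + two * c)) ⊎ IsSqℚ (r * (- a - two * c)))) →
           ∃ λ c → c * c ≡ b × IsSqℚ (r * (- a + two * c))
    from (c , c²≡b , inj₁ sq) = c , c²≡b , sq
    from (c , c²≡b , inj₂ sq) = - c , trans -c*-c≡c*c c²≡b , subst (λ e → IsSqℚ (r * e)) -a-2c≡-a+2[-c] sq
      where
      -c*-c≡c*c : - c * - c ≡ c * c
      -c*-c≡c*c = solve (c ∷ []) ring
      -a-2c≡-a+2[-c] : - a - two * c ≡ - a + two * - c
      -a-2c≡-a+2[-c] = solve (a ∷ c ∷ []) ring

lemma3p2 : (a b : ℚ) → Irreducible (quartic a b) → (r : ℚ) → ¬ IsSqℚ r →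
    (IsSqInExt (quartic a b) r ⇔
      (IsSqℚ (r * (a * a - four * b))
        ⊎ (∃ λ c → c * c ≡ b × (IsSqℚ (r * (- a + two * c)) ⊎ IsSqℚ (r * (- a - two * c))))))
lemma3p2 a b irreducible r r∉ℚ² = begin
  IsSqInExt (quartic a b) r
    ≈⟨ IsSqInExt⇔IsSqℚ[θ] ⟩
  IsSqℚ[θ] r
    ≈⟨ IsSqℚ[θ]⇔IsSqℚ[φ]⊎IsφSqℚ[φ] Δ∉ℚ² ⟩
  (IsSqℚ[φ] r ⊎ IsφSqℚ[φ] r)
    ≈⟨ IsSqℚ[φ]⇔IsSqℚ[r*Δ] Δ∉ℚ² r∉ℚ² ⊎-⇔ (±√b {r} ⇔-∘ IsφSqℚ[φ]⇔IsSqℚ[r*[2c-a]] Δ∉ℚ² r∉ℚ²) ⟩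
  (IsSqℚ (r * Δ) ⊎ (∃ λ c → c * c ≡ b × (IsSqℚ (r * (- a + two * c)) ⊎ IsSqℚ (r * (- a - two * c)))))
    ∎
  where
  open Quartic a b
  open ⇔-Reasoning
  Δ∉ℚ² : ¬ IsSqℚ Δ
  Δ∉ℚ² = irreducible⇒Δ∉ℚ² irreducible
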